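{- Let $G$ be a group with $\bigoplus_{n\in\omega}\mathbb{Z}\subseteq G\subseteq\mathbb{Z}^\omega$ and $|G|<\mathfrak{p}$. Then $G$ is not weakly $\bigoplus_{n\in\omega}\mathbb{Z}$-binding; that is, there is a homomorphism $G\to\bigoplus_{n\in\omega}\mathbb{Z}$ that extends to an endomorphism of $\mathbb{Z}^\omega$ and maps $\bigoplus_{n\in\omega}\mathbb{Z}$ onto a group of infinite rank.
   Context: $\bigoplus_{n\in\omega}\mathbb{Z}$ is regarded as the subgroup of $\mathbb{Z}^\omega$ of sequences with finitely many nonzero terms. Rank means torsion-free rank. $\mathfrak{p}$ is the pseudo-intersection number: the smallest cardinality of a family $\mathcal{F}$ of subsets of $\omega$ such that every finite subfamily has infinite intersection but there is no infinite $A\subseteq\omega$ with $A\setminus F$ finite for all $F\in\mathcal{F}$. -}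

module Defs where

open import Data.Nat using (ℕ; _≥_; zero; suc)
open import Data.Integer using (ℤ; _+_; _*_; -_; 0ℤ)
open import Data.Fin using (Fin) renaming (zero to fz; suc to fs)
open import Data.Vec.Functional using (Vector)
open import Data.List using (List)
open import Data.List.Relation.Unary.All using (All)
open import Data.Product using (Σ; ∃; ∃-syntax; _×_)
open import Relation.Binary.PropositionalEquality using (_≡_)

Seq : Set
Seq = ℕ → ℤ

_≈_ : Seq → Seq → Set
f ≈ g = ∀ n → f n ≡ g n

zeroS : Seq
zeroS _ = 0ℤ

_⊕_ : Seq → Seq → Seq
(f ⊕ g) n = f n + g n

negS : Seq → Seq
negS f n = - f n

_·_ : ℤ → Seq → Seq
(c · f) n = c * f n

FinSupp : Seq → Set
FinSupp f = ∃[ N ] (∀ m → m ≥ N → f m ≡ 0ℤ)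

record IsSubgroup (G : Seq → Set) : Set where
  field
    respects : ∀ {f g} → f ≈ g → G f → G g
    has-zero : G zeroS
    closed-+ : ∀ {f g} → G f → G g → G (f ⊕ g)
    closed-neg : ∀ {f} → G f → G (negS f)

record IsEndo (φ : Seq → Seq) : Set where
  field
    cong-≈ : ∀ {f g} → f ≈ g → φ f ≈ φ g
    additive : ∀ f g → φ (f ⊕ g) ≈ (φ f ⊕ φ g)

lincomb : ∀ n → Vector ℤ n → Vector Seq n → Seq
lincomb zero c x = zeroS
lincomb (suc n) c x = (c fz · x fz)
  ⊕ lincomb n (λ i → c (fs i)) (λ i → x (fs i))

LinIndep : ∀ n → Vector Seq n → Set
LinIndep n x = ∀ (c : Vector ℤ n) → lincomb n c x ≈ zeroS → ∀ i → c i ≡ 0ℤ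

-- the image φ[⊕ℤ] has infinite (torsion-free) rank:
-- for every n it contains n ℤ-linearly independent elements
InfiniteRankImage : (Seq → Seq) → Set
InfiniteRankImage φ = ∀ n → Σ (Vector Seq n) λ x → ((∀ i → FinSupp (x i)) × LinIndep n (λ i → φ (x i)))

Subset : Set₁
Subset = ℕ → Set

Infinite : Subset → Set
Infinite A = ∀ n → ∃[ m ] (m ≥ n × A m)

_⊆*_ : Subset → Subset → Set
A ⊆* B = ∃[ N ] (∀ m → m ≥ N → A m → B m)

SFIP : (I : Set) → (I → Subset) → Set
SFIP I F = ∀ (l : List I) → Infinite (λ m → All (λ i → F i m) l)

HasPseudoIntersection : (I : Set) → (I → Subset) → Set₁
HasPseudoIntersection I F = Σ Subset (λ A → Infinite A × (∀ i → A ⊆* F i))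

-- |I| < 𝔭 : every family of subsets of ω of size ≤ |I| (i.e. indexed by I)
-- with the SFIP has an infinite pseudo-intersection
BelowP : Set → Set₁
BelowP I = ∀ (F : I → Subset) → SFIP I F → HasPseudoIntersection I F

-- Code the nonzero finitely supported functionals ℤ^ω → ℤ by natural numbers. For
-- g ∈ G let K g be the set of codes of such functionals vanishing on g; finitely many
-- sequences are always killed by a nonzero functional, so {K g} has the strong finite
-- intersection property, and |G| < 𝔭 yields an infinite pseudo-intersection A. Pick
-- codes mₖ ∈ A so large that the functional cₖ of mₖ vanishes on the basis vectors
-- below the end of c₀, …, cₖ₋₁; then the cₖ live on consecutive disjoint blocks, and
-- φ f = (cₖ f)ₖ works: φ g is eventually 0 because A ⊆* K g and mₖ ≥ k, while φ maps
-- one basis vector from each block to a family that is diagonal, hence independent.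
module Submission where

open import Defs
open import Data.Product as Prod using (Σ; ∃; ∃-syntax; _×_; _,_; proj₁; proj₂)
open import Data.Nat as ℕ using (ℕ; zero; suc; _≤_; _<_; z≤n; s≤s; _⊔_; _≤′_)
open import Data.Nat.Properties
  using (≤-refl; ≤-trans; <-≤-trans; ≤⇒≤′; ≮⇒≥; ≰⇒>; m≤m+n; m≤n+m; m≤m⊔n; m≤n⊔m; <-cmp; +-suc; +-assoc; +-identityʳ; suc-injective)
open import Data.Integer using (ℤ; 0ℤ; 1ℤ; +_; -[1+_]; _+_; _*_; -_; _-_; _≟_)
import Data.Integer.Properties as ℤ
open import Data.Integer.Tactic.RingSolver using (solve-∀)
open import Data.Fin using (Fin; toℕ)
open import Data.Fin.Properties using (toℕ-injective)
import Data.Fin.Properties as Fin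
open import Data.List using (List; []; _∷_; _++_; map; length; applyUpTo)
open import Data.List.Properties using (length-map)
open import Data.List.Relation.Unary.All as All using (All; []; _∷_)
open import Data.List.Relation.Unary.All.Properties using (applyUpTo⁺₂; applyUpTo⁻; map⁻)
open import Data.Sum using (inj₁; inj₂)
open import Data.Empty using (⊥-elim)
open import Function using (_∘_)
open import Relation.Nullary using (yes; no)
open import Relation.Binary.Definitions using (tri<; tri≈; tri>)
open import Relation.Binary.PropositionalEquality
  using (_≡_; _≢_; refl; sym; trans; cong; cong₂; subst; module ≡-Reasoning)

next : ℕ × ℕ → ℕ × ℕ
next (a , zero)  = 0 , suc a
next (a , suc b) = suc a , b

unpair : ℕ → ℕ × ℕ
unpair zero    = 0 , 0
unpair (suc m) = next (unpair m)

proj₁-next≤ : ∀ p → proj₁ (next p) ≤ suc (proj₁ p)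
proj₁-next≤ (a , zero)  = z≤n
proj₁-next≤ (a , suc b) = ≤-refl

proj₁-unpair≤ : ∀ m → proj₁ (unpair m) ≤ m
proj₁-unpair≤ zero    = z≤n
proj₁-unpair≤ (suc m) = ≤-trans (proj₁-next≤ (unpair m)) (s≤s (proj₁-unpair≤ m))

unpair-onto-diagonal : ∀ s a b → a ℕ.+ b ≡ s → ∃ λ m → unpair m ≡ (a , b)
unpair-onto-diagonal _       zero    zero    _  = 0 , refl
unpair-onto-diagonal s       (suc a) b       eq =
  Prod.map suc (cong next) (unpair-onto-diagonal s a (suc b) (trans (+-suc a b) eq))
unpair-onto-diagonal (suc s) zero    (suc b) eq =
  Prod.map suc (cong next) (unpair-onto-diagonal s b 0 (trans (+-identityʳ b) (suc-injective eq)))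

unpair-onto : ∀ a b → ∃ λ m → unpair m ≡ (a , b)
unpair-onto a b = unpair-onto-diagonal (a ℕ.+ b) a b refl

toℤ : ℕ → ℤ
toℤ n = + proj₁ (unpair n) - + proj₂ (unpair n)

toℤ-onto : ∀ z → ∃ λ n → toℤ n ≡ z
toℤ-onto (+ a) with unpair-onto a 0
... | n , eq = n , trans (cong (λ p → + proj₁ p - + proj₂ p) eq) (ℤ.+-identityʳ (+ a))
toℤ-onto -[1+ a ] with unpair-onto 0 (suc a)
... | n , eq = n , cong (λ p → + proj₁ p - + proj₂ p) eq

decodeList : ℕ → ℕ → List ℤ
decodeList zero    r = []
decodeList (suc L) r = toℤ (proj₁ (unpair r)) ∷ decodeList L (proj₂ (unpair r))

decodeList-onto : ∀ d → ∃ λ r → decodeList (length d) r ≡ d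
decodeList-onto []      = 0 , refl
decodeList-onto (c ∷ d) with toℤ-onto c | decodeList-onto d
... | x , x↦c | r , r↦d with unpair-onto x r
... | n , n↦xr = n , trans (cong (λ p → toℤ (proj₁ p) ∷ decodeList (length d) (proj₂ p)) n↦xr)
                           (cong₂ _∷_ x↦c r↦d)

decode : ℕ → List ℤ
decode n = decodeList (proj₁ (unpair n)) (proj₂ (unpair n))

decode-onto : ∀ d → ∃ λ n → decode n ≡ d
decode-onto d with decodeList-onto d
... | r , r↦d with unpair-onto (length d) r
... | n , n↦Lr = n , trans (cong (λ p → decodeList (proj₁ p) (proj₂ p)) n↦Lr) r↦d

-- The first component of unpair m is padding: it only makes codes arbitrarily large.
functional : ℕ → List ℤ
functional m = decode (proj₂ (unpair m))

functional-onto-above : ∀ d n → ∃ λ m → n ≤ m × functional m ≡ d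
functional-onto-above d n with decode-onto d
... | r , r↦d with unpair-onto n r
... | m , m↦nr = m , subst (λ p → proj₁ p ≤ m) m↦nr (proj₁-unpair≤ m)
                   , trans (cong (decode ∘ proj₂) m↦nr) r↦d

shift : ℕ → Seq → Seq
shift k f n = f (k ℕ.+ n)

eval : List ℤ → Seq → ℤ
eval []      f = 0ℤ
eval (c ∷ d) f = c * f 0 + eval d (f ∘ suc)

coeff : List ℤ → ℕ → ℤ
coeff []      i       = 0ℤ
coeff (c ∷ d) zero    = c
coeff (c ∷ d) (suc i) = coeff d i

Nonzero : List ℤ → Set
Nonzero d = ∃ λ i → coeff d i ≢ 0ℤ

basis : ℕ → Seq
basis zero    zero    = 1ℤ
basis zero    (suc j) = 0ℤ
basis (suc i) zero    = 0ℤ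
basis (suc i) (suc j) = basis i j

basis-vanishes-above : ∀ {i j} → i < j → basis i j ≡ 0ℤ
basis-vanishes-above {zero}  {suc j} _         = refl
basis-vanishes-above {suc i} {suc j} (s≤s i<j) = basis-vanishes-above i<j

basis-finSupp : ∀ i → FinSupp (basis i)
basis-finSupp i = suc i , λ _ → basis-vanishes-above

zeroS-finSupp : FinSupp zeroS
zeroS-finSupp = 0 , λ _ _ → refl

eval-cong : ∀ d {f g} → f ≈ g → eval d f ≡ eval d g
eval-cong []      f≈g = refl
eval-cong (c ∷ d) f≈g = cong₂ _+_ (cong (c *_) (f≈g 0)) (eval-cong d (f≈g ∘ suc))

eval-⊕ : ∀ d f g → eval d (f ⊕ g) ≡ eval d f + eval d g
eval-⊕ []      f g = refl
eval-⊕ (c ∷ d) f g = trans (cong (_+_ (c * (f 0 + g 0))) (eval-⊕ d (f ∘ suc) (g ∘ suc)))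
                           (distrib c (f 0) (g 0) (eval d (f ∘ suc)) (eval d (g ∘ suc)))
  where
  distrib : ∀ c x y u v → c * (x + y) + (u + v) ≡ (c * x + u) + (c * y + v)
  distrib = solve-∀

eval-zeroS : ∀ d → eval d zeroS ≡ 0ℤ
eval-zeroS []      = refl
eval-zeroS (c ∷ d) = cong₂ _+_ (ℤ.*-zeroʳ c) (eval-zeroS d)

eval-basis : ∀ d i → eval d (basis i) ≡ coeff d i
eval-basis []      i       = refl
eval-basis (c ∷ d) zero    = trans (cong₂ _+_ (ℤ.*-identityʳ c) (eval-zeroS d)) (ℤ.+-identityʳ c)
eval-basis (c ∷ d) (suc i) = trans (cong₂ _+_ (ℤ.*-zeroʳ c) (eval-basis d i)) (ℤ.+-identityˡ _)

coeff-beyond-length : ∀ d {i} → length d ≤ i → coeff d i ≡ 0ℤ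
coeff-beyond-length []      _       = refl
coeff-beyond-length (c ∷ d) (s≤s p) = coeff-beyond-length d p

eval-++ : ∀ xs ys f → eval (xs ++ ys) f ≡ eval xs f + eval ys (shift (length xs) f)
eval-++ []       ys f = sym (ℤ.+-identityˡ _)
eval-++ (c ∷ xs) ys f = trans (cong (_+_ (c * f 0)) (eval-++ xs ys (f ∘ suc)))
                              (sym (ℤ.+-assoc (c * f 0) _ _))

eval-scale : ∀ a d f → eval (map (a *_) d) f ≡ a * eval d f
eval-scale a []      f = sym (ℤ.*-zeroʳ a)
eval-scale a (c ∷ d) f = trans (cong (_+_ (a * c * f 0)) (eval-scale a d (f ∘ suc)))
                               (factor a c (f 0) (eval d (f ∘ suc)))
  where
  factor : ∀ a c x u → a * c * x + a * u ≡ a * (c * x + u)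
  factor = solve-∀

coeff-scale : ∀ a d i → coeff (map (a *_) d) i ≡ a * coeff d i
coeff-scale a []      i       = sym (ℤ.*-zeroʳ a)
coeff-scale a (c ∷ d) zero    = refl
coeff-scale a (c ∷ d) (suc i) = coeff-scale a d i

coeff-++ʳ : ∀ xs ys i → coeff (xs ++ ys) (length xs ℕ.+ i) ≡ coeff ys i
coeff-++ʳ []       ys i = refl
coeff-++ʳ (c ∷ xs) ys i = coeff-++ʳ xs ys i

shift-shift : ∀ k l f → shift l (shift k f) ≈ shift (k ℕ.+ l) f
shift-shift k l f n = cong f (sym (+-assoc k l n))

eval-juxtapose : ∀ β α d₁ d₂ k f →
  eval (map (β *_) d₁ ++ map (α *_) d₂) (shift k f)
    ≡ β * eval d₁ (shift k f) + α * eval d₂ (shift (k ℕ.+ length d₁) f)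
eval-juxtapose β α d₁ d₂ k f = begin
  eval (map (β *_) d₁ ++ map (α *_) d₂) (shift k f)
    ≡⟨ eval-++ (map (β *_) d₁) (map (α *_) d₂) (shift k f) ⟩
  eval (map (β *_) d₁) (shift k f) + eval (map (α *_) d₂) (shift (length (map (β *_) d₁)) (shift k f))
    ≡⟨ cong₂ _+_ (eval-scale β d₁ (shift k f)) (eval-scale α d₂ _) ⟩
  β * eval d₁ (shift k f) + α * eval d₂ (shift (length (map (β *_) d₁)) (shift k f))
    ≡⟨ cong (λ L → β * eval d₁ (shift k f) + α * eval d₂ (shift L (shift k f))) (length-map (β *_) d₁) ⟩
  β * eval d₁ (shift k f) + α * eval d₂ (shift (length d₁) (shift k f))
    ≡⟨ cong (λ x → β * eval d₁ (shift k f) + α * x) (eval-cong d₂ (shift-shift k (length d₁) f)) ⟩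
  β * eval d₁ (shift k f) + α * eval d₂ (shift (k ℕ.+ length d₁) f)
    ∎
  where open ≡-Reasoning

-- The shift parameter makes the induction go through: the second functional is built
-- for the tails beyond the support of the first one.
annihilator : ∀ (gs : List Seq) k → ∃ λ d → Nonzero d × All (λ g → eval d (shift k g) ≡ 0ℤ) gs
annihilator []       k = 1ℤ ∷ [] , (0 , λ ()) , []
annihilator (g ∷ gs) k with annihilator gs k
... | d₁ , nz₁ , kills₁ with annihilator gs (k ℕ.+ length d₁) | eval d₁ (shift k g) ≟ 0ℤ
...   | _                    | yes kills₁g = d₁ , nz₁ , kills₁g ∷ kills₁
...   | d₂ , (i , nz₂) , kills₂ | no a≢0 =
  d , (length (map (- b *_) d₁) ℕ.+ i , nonzero) , kills-g ∷ All.zipWith (λ {h} → kills-gs {h}) (kills₁ , kills₂)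
  where
  a = eval d₁ (shift k g)
  b = eval d₂ (shift (k ℕ.+ length d₁) g)
  d = map (- b *_) d₁ ++ map (a *_) d₂

  nonzero : coeff d (length (map (- b *_) d₁) ℕ.+ i) ≢ 0ℤ
  nonzero eq with ℤ.i*j≡0⇒i≡0∨j≡0 a (trans (sym (coeff-scale a d₂ i))
                                        (trans (sym (coeff-++ʳ (map (- b *_) d₁) _ i)) eq))
  ... | inj₁ a≡0 = a≢0 a≡0
  ... | inj₂ c≡0 = nz₂ c≡0

  cancel : ∀ a b → - b * a + a * b ≡ 0ℤ
  cancel = solve-∀

  kills-g : eval d (shift k g) ≡ 0ℤ
  kills-g = trans (eval-juxtapose (- b) a d₁ d₂ k g) (cancel a b)

  kills-gs : ∀ {h} → eval d₁ (shift k h) ≡ 0ℤ × eval d₂ (shift (k ℕ.+ length d₁) h) ≡ 0ℤ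
           → eval d (shift k h) ≡ 0ℤ
  kills-gs {h} (e₁ , e₂) = trans (eval-juxtapose (- b) a d₁ d₂ k h)
    (trans (cong₂ (λ x y → - b * x + a * y) e₁ e₂) (cong₂ _+_ (ℤ.*-zeroʳ (- b)) (ℤ.*-zeroʳ a)))

KillerCodes : Seq → Subset
KillerCodes g m = Nonzero (functional m) × eval (functional m) g ≡ 0ℤ

killerCodes-SFIP : ∀ (G : Seq → Set) → SFIP (Σ Seq G) (KillerCodes ∘ proj₁)
killerCodes-SFIP G xs n with annihilator (map proj₁ xs) 0
... | d , nz , kills with functional-onto-above d n
... | m , n≤m , m↦d = m , n≤m
  , subst (λ d → All (λ x → Nonzero d × eval d (proj₁ x) ≡ 0ℤ) xs) (sym m↦d)
          (All.map (nz ,_) (map⁻ kills))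

⊆*-All : ∀ {I : Set} {A : Subset} {F : I → Subset} {xs : List I}
       → All (λ i → A ⊆* F i) xs → A ⊆* (λ m → All (λ i → F i m) xs)
⊆*-All []                            = 0 , λ _ _ _ → []
⊆*-All ((N , A⊆F) ∷ A⊆*Fs) with ⊆*-All A⊆*Fs
... | N′ , A⊆Fs = N ⊔ N′ , λ m m≥ m∈A →
  A⊆F m (≤-trans (m≤m⊔n N N′) m≥) m∈A ∷ A⊆Fs m (≤-trans (m≤n⊔m N N′) m≥) m∈A

lincomb-vanishing : ∀ n (c : Fin n → ℤ) y k → (∀ j → y j k ≡ 0ℤ) → lincomb n c y k ≡ 0ℤ
lincomb-vanishing zero    c y k _      = refl
lincomb-vanishing (suc n) c y k y·k≡0 =
  cong₂ _+_ (trans (cong (c Fin.zero *_) (y·k≡0 Fin.zero)) (ℤ.*-zeroʳ (c Fin.zero)))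
            (lincomb-vanishing n (c ∘ Fin.suc) (y ∘ Fin.suc) k (y·k≡0 ∘ Fin.suc))

lincomb-single : ∀ n (c : Fin n → ℤ) y k i → (∀ j → j ≢ i → y j k ≡ 0ℤ)
               → lincomb n c y k ≡ c i * y i k
lincomb-single (suc n) c y k Fin.zero    others =
  trans (cong (_+_ (c Fin.zero * y Fin.zero k))
              (lincomb-vanishing n (c ∘ Fin.suc) (y ∘ Fin.suc) k (λ j → others (Fin.suc j) λ ())))
        (ℤ.+-identityʳ _)
lincomb-single (suc n) c y k (Fin.suc i) others =
  trans (cong₂ _+_ (trans (cong (c Fin.zero *_) (others Fin.zero λ ())) (ℤ.*-zeroʳ (c Fin.zero)))
                   (lincomb-single n (c ∘ Fin.suc) (y ∘ Fin.suc) k i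
                      (λ j j≢i → others (Fin.suc j) (j≢i ∘ Fin.suc-injective))))
        (ℤ.+-identityˡ _)

diagonal⇒LinIndep : ∀ n (y : Fin n → Seq) (κ : Fin n → ℕ)
                  → (∀ i j → j ≢ i → y j (κ i) ≡ 0ℤ) → (∀ i → y i (κ i) ≢ 0ℤ)
                  → LinIndep n y
diagonal⇒LinIndep n y κ off-diagonal diagonal c Σcy≈0 i
  with ℤ.i*j≡0⇒i≡0∨j≡0 (c i) (trans (sym (lincomb-single n c y (κ i) i (off-diagonal i))) (Σcy≈0 (κ i)))
... | inj₁ cᵢ≡0 = cᵢ≡0
... | inj₂ yᵢ≡0 = ⊥-elim (diagonal i yᵢ≡0)

module Blocks (A : Subset) (A-infinite : Infinite A)
              (A⊆*killers : ∀ {g} → FinSupp g → A ⊆* KillerCodes g) where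

  -- zeroS only serves to make the block nonzero, even when B = 0.
  controls : ℕ → List Seq
  controls B = zeroS ∷ applyUpTo basis B

  opaque
    good-code : ∀ k B → ∃ λ m → k ≤ m × A m × All (λ g → KillerCodes g m) (controls B)
    good-code k B with ⊆*-All (All.map A⊆*killers (zeroS-finSupp ∷ applyUpTo⁺₂ basis B basis-finSupp))
    ... | N , killed with A-infinite (k ⊔ N)
    ... | m , m≥ , m∈A = m , ≤-trans (m≤m⊔n k N) m≥ , m∈A , killed m (≤-trans (m≤n⊔m k N) m≥) m∈A

  mutual
    code : ℕ → ℕ
    code k = proj₁ (good-code k (start k))

    start : ℕ → ℕ
    start zero    = 0
    start (suc k) = start k ℕ.+ length (functional (code k))

  block : ℕ → List ℤ
  block k = functional (code k)

  code-≥ : ∀ k → k ≤ code k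
  code-≥ k = proj₁ (proj₂ (good-code k (start k)))

  code-∈A : ∀ k → A (code k)
  code-∈A k = proj₁ (proj₂ (proj₂ (good-code k (start k))))

  block-killed : ∀ k → All (λ g → KillerCodes g (code k)) (controls (start k))
  block-killed k = proj₂ (proj₂ (proj₂ (good-code k (start k))))

  block-vanishes-below : ∀ k {i} → i < start k → coeff (block k) i ≡ 0ℤ
  block-vanishes-below k i<start with block-killed k
  ... | _ ∷ killed = trans (sym (eval-basis (block k) _)) (proj₂ (applyUpTo⁻ basis (start k) killed i<start))

  pivot : ℕ → ℕ
  pivot k with block-killed k
  ... | (nonzero , _) ∷ _ = proj₁ nonzero

  pivot-nonzero : ∀ k → coeff (block k) (pivot k) ≢ 0ℤ
  pivot-nonzero k with block-killed k
  ... | (nonzero , _) ∷ _ = proj₂ nonzero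

  start-mono : ∀ {j k} → j ≤′ k → start j ≤ start k
  start-mono ℕ.≤′-refl      = ≤-refl
  start-mono (ℕ.≤′-step j≤k) = ≤-trans (start-mono j≤k) (m≤m+n _ _)

  start≤pivot : ∀ k → start k ≤ pivot k
  start≤pivot k = ≮⇒≥ (pivot-nonzero k ∘ block-vanishes-below k)

  pivot<start : ∀ k → pivot k < start (suc k)
  pivot<start k = <-≤-trans (≰⇒> (pivot-nonzero k ∘ coeff-beyond-length (block k)))
                            (m≤n+m _ (start k))

  block-vanishes-at-pivot : ∀ j k → j ≢ k → coeff (block j) (pivot k) ≡ 0ℤ
  block-vanishes-at-pivot j k j≢k with <-cmp j k
  ... | tri< j<k _ _ = coeff-beyond-length (block j)
          (≤-trans (m≤n+m _ (start j)) (≤-trans (start-mono (≤⇒≤′ j<k)) (start≤pivot k)))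
  ... | tri≈ _ j≡k _ = ⊥-elim (j≢k j≡k)
  ... | tri> _ _ k<j = block-vanishes-below j (<-≤-trans (pivot<start k) (start-mono (≤⇒≤′ k<j)))

  φ : Seq → Seq
  φ f k = eval (block k) f

  φ-endo : IsEndo φ
  φ-endo = record { cong-≈ = λ f≈g k → eval-cong (block k) f≈g ; additive = λ f g k → eval-⊕ (block k) f g }

  φ-finSupp : ∀ {g} → A ⊆* KillerCodes g → FinSupp (φ g)
  φ-finSupp (N , A⊆K) = N , λ k k≥N → proj₂ (A⊆K (code k) (≤-trans k≥N (code-≥ k)) (code-∈A k))

  φ-infiniteRank : InfiniteRankImage φ
  φ-infiniteRank n = basis ∘ pivot ∘ toℕ , basis-finSupp ∘ pivot ∘ toℕ
    , diagonal⇒LinIndep n (φ ∘ basis ∘ pivot ∘ toℕ) toℕ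
        (λ i j j≢i → trans (eval-basis (block (toℕ i)) _)
                           (block-vanishes-at-pivot (toℕ i) (toℕ j) (j≢i ∘ toℕ-injective ∘ sym)))
        (λ i → pivot-nonzero (toℕ i) ∘ trans (sym (eval-basis (block (toℕ i)) _)))

theorem9 : (G : Seq → Set) → IsSubgroup G
    → (∀ f → FinSupp f → G f)
    → BelowP (Σ Seq G)
    → ∃[ φ ] (IsEndo φ × (∀ g → G g → FinSupp (φ g)) × InfiniteRankImage φ)
theorem9 G _ finSupp⊆G G<𝔭 with G<𝔭 (KillerCodes ∘ proj₁) (killerCodes-SFIP G)
... | A , A-infinite , A⊆*killers = φ , φ-endo , (λ g g∈G → φ-finSupp (A⊆*killers (g , g∈G))) , φ-infiniteRank
  where open Blocks A A-infinite (λ {g} fin → A⊆*killers (g , finSupp⊆G g fin))
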